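{- Let $\varphi$ be a $\mathrm{D}$-formula. The number of distinct atoms occurring in a $\varphi$-row is at most $2|\varphi|$. Moreover, if $A_0^{m_0}\cdots A_n^{m_n}$ is the maximal factorization of a $\varphi$-row, then $A_0,\dots,A_n$ are pairwise distinct.
   Context: Formulas: $\varphi ::= p\mid\neg\varphi\mid\varphi\vee\varphi\mid\langle D\rangle\varphi$, $p\in\mathcal{AP}$; $[D]\psi:=\neg\langle D\rangle\neg\psi$; $|\varphi|$ is the number of subformulas of $\varphi$. $\mathrm{CL}(\varphi)$: subformulas and their negations, identifying $\neg\neg\psi$ with $\psi$ and $\neg\langle D\rangle\psi$ with $[D]\neg\psi$. A $\varphi$-atom is $A\subseteq\mathrm{CL}(\varphi)$ with $\psi\in A$ iff $\neg\psi\notin A$, and $\psi_1\vee\psi_2\in A$ iff $\psi_1\in A$ or $\psi_2\in A$. $\mathcal{R}eq_D(A)=\{\psi:\langle D\rangle\psi\in A\}$. $A\,D_\varphi\,A'$ iff for every $[D]\psi\in A$, $\psi\in A'$ and $[D]\psi\in A'$. A $\varphi$-row is a nonempty finite sequence $row[0]\cdots row[k-1]$ of $\varphi$-atoms with $row[i+1]\,D_\varphi\,row[i]$ and $row[i]\cap\mathcal{AP}\supseteq row[i+1]\cap\mathcal{AP}$ for all $i<k-1$. Its maximal factorization is the writing $A_0^{m_0}\cdots A_n^{m_n}$, where $A^m$ denotes $m$ consecutive copies of $A$, $m_i>0$, and $A_i\ne A_{i+1}$. -}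

module Defs where

open import Data.Nat using (ℕ; _*_; _≤_; _>_)
import Data.Nat.Properties as ℕP
open import Data.Bool using (Bool)
import Data.Bool.Properties as BP
open import Data.List using (List; []; _∷_; length; map; _++_; deduplicate; concatMap; replicate; lookup)
open import Data.List.Relation.Unary.All using (All)
open import Data.List.Relation.Unary.Linked using (Linked)
open import Data.List.Relation.Unary.AllPairs using (AllPairs)
open import Data.List.Membership.Propositional using (_∈_)
open import Data.Fin using (Fin)
open import Data.Fin.Subset using (Subset) renaming (_∈_ to _∈ₛ_)
import Data.Vec.Properties as VP
open import Data.Product using (Σ; ∃; _×_; _,_; proj₁; proj₂)
open import Data.Sum using (_⊎_)
open import Relation.Nullary using (¬_; Dec; yes; no)
open import Relation.Binary.PropositionalEquality using (_≡_; _≢_; refl; cong; cong₂)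
open import Relation.Binary.Definitions using (DecidableEquality)
open import Function.Bundles using (_⇔_)

data Fm : Set where
  var : ℕ → Fm
  neg : Fm → Fm
  _∨ᶠ_ : Fm → Fm → Fm
  dia : Fm → Fm

box : Fm → Fm
box ψ = neg (dia (neg ψ))

_≟ᶠ_ : DecidableEquality Fm
var m ≟ᶠ var n with m ℕP.≟ n
... | yes refl = yes refl
... | no ne = no λ { refl → ne refl }
var _ ≟ᶠ neg _ = no λ ()
var _ ≟ᶠ (_ ∨ᶠ _) = no λ ()
var _ ≟ᶠ dia _ = no λ ()
neg _ ≟ᶠ var _ = no λ ()
neg a ≟ᶠ neg b with a ≟ᶠ b
... | yes refl = yes refl
... | no ne = no λ { refl → ne refl }
neg _ ≟ᶠ (_ ∨ᶠ _) = no λ ()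
neg _ ≟ᶠ dia _ = no λ ()
(_ ∨ᶠ _) ≟ᶠ var _ = no λ ()
(_ ∨ᶠ _) ≟ᶠ neg _ = no λ ()
(a ∨ᶠ b) ≟ᶠ (c ∨ᶠ d) with a ≟ᶠ c | b ≟ᶠ d
... | yes refl | yes refl = yes refl
... | no ne | _ = no λ { refl → ne refl }
... | yes _ | no ne = no λ { refl → ne refl }
(_ ∨ᶠ _) ≟ᶠ dia _ = no λ ()
dia _ ≟ᶠ var _ = no λ ()
dia _ ≟ᶠ neg _ = no λ ()
dia _ ≟ᶠ (_ ∨ᶠ _) = no λ ()
dia a ≟ᶠ dia b with a ≟ᶠ b
... | yes refl = yes refl
... | no ne = no λ { refl → ne refl }

subs : Fm → List Fm
subs (var p) = var p ∷ []
subs (neg a) = neg a ∷ subs a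
subs (a ∨ᶠ b) = (a ∨ᶠ b) ∷ subs a ++ subs b
subs (dia a) = dia a ∷ subs a

-- |φ| : number of (distinct) subformulas of φ
size : Fm → ℕ
size φ = length (deduplicate _≟ᶠ_ (subs φ))

-- Identification of ¬¬ψ with ψ: every formula is represented by its
-- normal form, in which double negations are collapsed.  (Then ¬⟨D⟩ψ and
-- [D]¬ψ = ¬⟨D⟩¬¬ψ have the same normal form.)

∼_ : Fm → Fm
∼ neg a = a
∼ var p = neg (var p)
∼ (a ∨ᶠ b) = neg (a ∨ᶠ b)
∼ dia a = neg (dia a)

nf : Fm → Fm
nf (var p) = var p
nf (neg a) = ∼ nf a
nf (a ∨ᶠ b) = nf a ∨ᶠ nf b
nf (dia a) = dia (nf a)

CL : Fm → List Fm
CL φ = deduplicate _≟ᶠ_ (map nf (subs φ) ++ map (λ ψ → nf (neg ψ)) (subs φ))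

_∈CL_ : Fm → Fm → Set
ψ ∈CL φ = nf ψ ∈ CL φ

-- A subset of CL(φ), given by its characteristic vector over the list CL φ
SubCL : Fm → Set
SubCL φ = Subset (length (CL φ))

mem : (φ : Fm) → Fm → SubCL φ → Set
mem φ ψ A = Σ (Fin (length (CL φ))) λ i → (lookup (CL φ) i ≡ nf ψ) × (i ∈ₛ A)

record IsAtom (φ : Fm) (A : SubCL φ) : Set where
  field
    negation : ∀ ψ → ψ ∈CL φ → (mem φ ψ A ⇔ (¬ mem φ (neg ψ) A))
    disjunction : ∀ ψ₁ ψ₂ → (ψ₁ ∨ᶠ ψ₂) ∈CL φ →
                  (mem φ (ψ₁ ∨ᶠ ψ₂) A ⇔ (mem φ ψ₁ A ⊎ mem φ ψ₂ A))

DRel : (φ : Fm) → SubCL φ → SubCL φ → Set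
DRel φ A A' = ∀ ψ → mem φ (box ψ) A → mem φ ψ A' × mem φ (box ψ) A'

APsup : (φ : Fm) → SubCL φ → SubCL φ → Set
APsup φ A A' = ∀ p → mem φ (var p) A' → mem φ (var p) A

-- condition between row[i] = A and row[i+1] = A'
RowStep : (φ : Fm) → SubCL φ → SubCL φ → Set
RowStep φ A A' = DRel φ A' A × APsup φ A A'

record IsRow (φ : Fm) (row : List (SubCL φ)) : Set where
  field
    nonempty : row ≢ []
    atoms : All (IsAtom φ) row
    steps : Linked (RowStep φ) row

_≟ₛ_ : {n : ℕ} → DecidableEquality (Subset n)
_≟ₛ_ = VP.≡-dec BP._≟_

distinctCount : {n : ℕ} → List (Subset n) → ℕ
distinctCount xs = length (deduplicate _≟ₛ_ xs)

-- A_0^{m_0} ⋯ A_n^{m_n}, as a list of pairs (A_i , m_i)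
expand : {X : Set} → List (X × ℕ) → List X
expand = concatMap (λ p → replicate (proj₂ p) (proj₁ p))

record IsMaxFact {X : Set} (row : List X) (fac : List (X × ℕ)) : Set where
  field
    positive : All (λ p → proj₂ p > 0) fac
    adjDistinct : Linked (λ p q → proj₁ p ≢ proj₁ q) fac
    covers : expand fac ≡ row

-- An atom is determined by its core: the letters p and the formulas [D]¬ψ (= ¬⟨D⟩ψ)
-- it contains, for ψ a subformula of φ; the other members of CL(φ) follow from
-- these by the atom conditions.  Along a row the core can only shrink, since
-- row[i+1] D_φ row[i] and the letter condition pass both the boxes and the
-- letters of row[i+1] on to row[i].
-- Hence the atoms of a row are linearly preordered by core inclusion, which is
-- antisymmetric on atoms: distinct atoms of a row have cores of distinct sizes
-- in 0 … |φ|, so there are at most |φ| + 1 ≤ 2|φ| of them, and an atom cannot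
-- reappear after a different one without everything in between being equal.
module Submission where

open import Defs
open import Data.Nat using (ℕ; zero; suc; _*_; _+_; _≤_; _<_; _>_; z≤n; s≤s)
import Data.Nat.Properties as ℕP
open import Data.List using (List; []; _∷_; length; map; _++_; filter; deduplicate; replicate; lookup)
import Data.List.Properties as ListP
open import Data.List.Relation.Unary.All as All using (All; []; _∷_)
import Data.List.Relation.Unary.All.Properties as AllP
open import Data.List.Relation.Unary.Any using (here; there)
open import Data.List.Relation.Unary.AllPairs as AllPairs using (AllPairs; []; _∷_)
import Data.List.Relation.Unary.AllPairs.Properties as AllPairsP
open import Data.List.Relation.Unary.Linked as Linked using (Linked; []; [-]; _∷_)
import Data.List.Relation.Unary.Linked.Properties as LinkedP
open import Data.List.Relation.Unary.Unique.Propositional using (Unique)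
open import Data.List.Relation.Unary.Unique.DecPropositional.Properties using (deduplicate-!)
open import Data.List.Relation.Binary.Sublist.Propositional as Sublist using ([]; _∷_; _∷ʳ_)
  renaming (_⊆_ to _⊑ˡ_)
import Data.List.Relation.Binary.Sublist.Propositional.Properties as SublistP
open import Data.List.Relation.Binary.Equality.Propositional using (≋⇒≡)
open import Data.List.Membership.Propositional using (_∈_)
open import Data.List.Membership.Propositional.Properties
  using (∈-deduplicate⁺; ∈-deduplicate⁻; ∈-map⁺; ∈-map⁻; ∈-++⁺ˡ; ∈-++⁺ʳ; ∈-++⁻; ∈-lookup;
         ∈-filter⁺; ∈-filter⁻)
open import Data.Fin using (zero; suc)
open import Data.Fin.Properties using (any?)
open import Data.Fin.Subset using (_⊆_) renaming (_∈_ to _∈ₛ_)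
open import Data.Fin.Subset.Properties using (_∈?_; ⊆-antisym)
open import Data.Product using (∃; _×_; _,_; proj₁; proj₂)
open import Data.Sum using (_⊎_; inj₁; inj₂; [_,_]′)
open import Data.Sum.Function.Propositional using (_⊎-cong_)
open import Data.Empty using (⊥)
open import Function using (_∘_)
open import Function.Bundles using (_⇔_; mk⇔; Equivalence)
import Function.Properties.Equivalence as ⇔
open import Relation.Unary using (Decidable)
open import Relation.Nullary using (¬_; Dec; no; contradiction)
open import Relation.Nullary.Decidable using (_×-dec_; decidable-stable)
open import Relation.Binary.PropositionalEquality using (_≡_; _≢_; refl; sym; trans; cong; subst)

open Equivalence using (to; from)

module _ {X : Set} where

  AllPairs-resp-⊆ : ∀ {R : X → X → Set} {xs ys} → xs ⊑ˡ ys → AllPairs R ys → AllPairs R xs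
  AllPairs-resp-⊆ [] [] = []
  AllPairs-resp-⊆ (_ ∷ʳ τ) (_ ∷ rs) = AllPairs-resp-⊆ τ rs
  AllPairs-resp-⊆ (refl ∷ τ) (r ∷ rs) = SublistP.All-resp-⊆ τ r ∷ AllPairs-resp-⊆ τ rs

  AllPairs-map-All : ∀ {P : X → Set} {R S : X → X → Set} →
    (∀ {a b} → P a → P b → R a b → S a b) → ∀ {xs} → All P xs → AllPairs R xs → AllPairs S xs
  AllPairs-map-All f [] [] = []
  AllPairs-map-All f (pa ∷ ps) (r ∷ rs) =
    All.zipWith (λ (pb , rb) → f pa pb rb) (ps , r) ∷ AllPairs-map-All f ps rs

  deduplicate-⊆ : ∀ {R : X → X → Set} (R? : ∀ x y → Dec (R x y)) xs → deduplicate R? xs ⊑ˡ xs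
  deduplicate-⊆ R? [] = []
  deduplicate-⊆ R? (x ∷ xs) =
    refl ∷ Sublist.⊆-trans (SublistP.filter-⊆ _ (deduplicate R? xs)) (deduplicate-⊆ R? xs)

  lookup-injective : ∀ {xs : List X} → Unique xs → ∀ i j → lookup xs i ≡ lookup xs j → i ≡ j
  lookup-injective (_ ∷ _) zero zero _ = refl
  lookup-injective (x∉ ∷ _) zero (suc j) e = contradiction e (All.lookup x∉ (∈-lookup j))
  lookup-injective (x∉ ∷ _) (suc i) zero e = contradiction (sym e) (All.lookup x∉ (∈-lookup i))
  lookup-injective (_ ∷ u) (suc i) (suc j) e = cong suc (lookup-injective u i j e)

  module _ {P Q : X → Set} (P? : Decidable P) (Q? : Decidable Q) (P⇒Q : ∀ {x} → P x → Q x) where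

    filter-mono-⊆ : ∀ xs → filter P? xs ⊑ˡ filter Q? xs
    filter-mono-⊆ xs = SublistP.filter⁺ P? Q? (λ { refl → P⇒Q }) (Sublist.⊆-refl {x = xs})

    length-filter-mono : ∀ xs → length (filter P? xs) ≤ length (filter Q? xs)
    length-filter-mono xs = SublistP.length-mono-≤ (filter-mono-⊆ xs)

    length-filter-≡⇒⊇ : ∀ {xs} → length (filter P? xs) ≡ length (filter Q? xs) →
      ∀ {x} → x ∈ xs → Q x → P x
    length-filter-≡⇒⊇ {xs} eq x∈ qx =
      proj₂ (∈-filter⁻ P? {xs = xs} (subst (_ ∈_) (sym filters≡) (∈-filter⁺ Q? {xs = xs} x∈ qx)))
      where
      filters≡ : filter P? xs ≡ filter Q? xs
      filters≡ = ≋⇒≡ (SublistP.to-≋ eq (filter-mono-⊆ xs))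

  sorted-adjacent-distinct⇒distinct : ∀ {P : X → Set} {R : X → X → Set} →
    (∀ {a b} → P a → P b → R a b → R b a → a ≡ b) →
    ∀ {xs} → All P xs → AllPairs R xs → Linked _≢_ xs → AllPairs _≢_ xs
  sorted-adjacent-distinct⇒distinct antisym [] [] [] = []
  sorted-adjacent-distinct⇒distinct antisym (_ ∷ []) ([] ∷ []) [-] = [] ∷ []
  sorted-adjacent-distinct⇒distinct {R = R} antisym (px ∷ py ∷ ps) ((rxy ∷ _) ∷ ry∷rs) (x≢y ∷ link) =
    (x≢y ∷ All.map (λ ryz x≡z → x≢y (antisym px py rxy (subst (R _) (sym x≡z) ryz))) (AllPairs.head ry∷rs))
    ∷ sorted-adjacent-distinct⇒distinct antisym (py ∷ ps) ry∷rs link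

  heads⊆expand : ∀ {fac : List (X × ℕ)} → All (λ p → proj₂ p > 0) fac → map proj₁ fac ⊑ˡ expand fac
  heads⊆expand [] = []
  heads⊆expand {(a , suc m) ∷ fac} (_ ∷ pos) = refl ∷ SublistP.++⁺ˡ (replicate m a) (heads⊆expand pos)

length-strictly-decreasing : ∀ K {ns : List ℕ} → All (_≤ K) ns → AllPairs _>_ ns → length ns ≤ suc K
length-strictly-decreasing K [] [] = z≤n
length-strictly-decreasing K (_ ∷ []) ([] ∷ []) = s≤s z≤n
length-strictly-decreasing zero (n≤0 ∷ _) ((m<n ∷ _) ∷ _) = contradiction (ℕP.<-≤-trans m<n n≤0) ℕP.n≮0
length-strictly-decreasing (suc K) (n≤ ∷ _) (ms<n ∷ dec) =
  s≤s (length-strictly-decreasing K (All.map (λ m<n → ℕP.≤-pred (ℕP.<-≤-trans m<n n≤)) ms<n) dec)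

suc≤2* : ∀ {n} → 1 ≤ n → suc n ≤ 2 * n
suc≤2* {n} 1≤n =
  ℕP.≤-trans (ℕP.+-monoˡ-≤ n 1≤n) (ℕP.≤-reflexive (cong (n +_) (sym (ℕP.+-identityʳ n))))

¬-cong : ∀ {A B : Set} → A ⇔ B → (¬ A) ⇔ (¬ B)
¬-cong A⇔B = mk⇔ (λ ¬a → ¬a ∘ from A⇔B) (λ ¬b → ¬b ∘ to A⇔B)

∼-involutive-nf : ∀ ψ → ∼ (∼ (nf ψ)) ≡ nf ψ
∼-involutive-nf (var p) = refl
∼-involutive-nf (neg ψ) = cong ∼_ (∼-involutive-nf ψ)
∼-involutive-nf (ψ ∨ᶠ χ) = refl
∼-involutive-nf (dia ψ) = refl

subs-refl : ∀ ψ → ψ ∈ subs ψ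
subs-refl (var p) = here refl
subs-refl (neg ψ) = here refl
subs-refl (ψ ∨ᶠ χ) = here refl
subs-refl (dia ψ) = here refl

subs-trans : ∀ φ {ψ χ} → ψ ∈ subs φ → χ ∈ subs ψ → χ ∈ subs φ
subs-trans (var p) (here refl) χ∈ = χ∈
subs-trans (neg φ) (here refl) χ∈ = χ∈
subs-trans (neg φ) (there ψ∈) χ∈ = there (subs-trans φ ψ∈ χ∈)
subs-trans (φ₁ ∨ᶠ φ₂) (here refl) χ∈ = χ∈
subs-trans (φ₁ ∨ᶠ φ₂) (there ψ∈) χ∈ with ∈-++⁻ (subs φ₁) ψ∈
... | inj₁ ψ∈₁ = there (∈-++⁺ˡ (subs-trans φ₁ ψ∈₁ χ∈))
... | inj₂ ψ∈₂ = there (∈-++⁺ʳ (subs φ₁) (subs-trans φ₂ ψ∈₂ χ∈))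
subs-trans (dia φ) (here refl) χ∈ = χ∈
subs-trans (dia φ) (there ψ∈) χ∈ = there (subs-trans φ ψ∈ χ∈)

size-positive : ∀ φ → 1 ≤ size φ
size-positive (var p) = s≤s z≤n
size-positive (neg φ) = s≤s z≤n
size-positive (φ ∨ᶠ ψ) = s≤s z≤n
size-positive (dia φ) = s≤s z≤n

module Atoms (φ : Fm) where

  mem? : ∀ ψ A → Dec (mem φ ψ A)
  mem? ψ A = any? (λ i → (lookup (CL φ) i ≟ᶠ nf ψ) ×-dec (i ∈? A))

  mem-nf : ∀ A ψ ψ' → nf ψ ≡ nf ψ' → mem φ ψ A ⇔ mem φ ψ' A
  mem-nf A ψ ψ' e = mk⇔ (λ (i , l , i∈) → i , trans l e , i∈) (λ (i , l , i∈) → i , trans l (sym e) , i∈)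

  mem-neg : ∀ {C} χ → IsAtom φ C → χ ∈CL φ → mem φ (neg χ) C ⇔ (¬ mem φ χ C)
  mem-neg {C} χ atomC χ∈ = mk⇔
    (λ m¬χ mχ → to (IsAtom.negation atomC χ χ∈) mχ m¬χ)
    (λ ¬mχ → decidable-stable (mem? (neg χ) C) (¬mχ ∘ from (IsAtom.negation atomC χ χ∈)))

  subs⇒∈CL : ∀ {ψ} → ψ ∈ subs φ → ψ ∈CL φ
  subs⇒∈CL ψ∈ = ∈-deduplicate⁺ _≟ᶠ_ (∈-++⁺ˡ (∈-map⁺ nf ψ∈))

  lookup-CL : ∀ i → ∃ λ ψ → ψ ∈ subs φ × (lookup (CL φ) i ≡ nf ψ ⊎ lookup (CL φ) i ≡ nf (neg ψ))
  lookup-CL i with ∈-++⁻ (map nf (subs φ)) (∈-deduplicate⁻ _≟ᶠ_ _ (∈-lookup i))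
  ... | inj₁ m = let ψ , ψ∈ , e = ∈-map⁻ nf m in ψ , ψ∈ , inj₁ e
  ... | inj₂ m = let ψ , ψ∈ , e = ∈-map⁻ (nf ∘ neg) m in ψ , ψ∈ , inj₂ e

  CL-unique : Unique (CL φ)
  CL-unique = deduplicate-! _≟ᶠ_ (map nf (subs φ) ++ map (nf ∘ neg) (subs φ))

  mem⇒∈ₛ : ∀ ψ {A i} → lookup (CL φ) i ≡ nf ψ → mem φ ψ A → i ∈ₛ A
  mem⇒∈ₛ ψ {A} {i} e (j , e' , j∈A) =
    subst (_∈ₛ A) (lookup-injective CL-unique j i (trans e' (sym e))) j∈A

  -- The core of A, indexed by subformulas: p stands for p and ⟨D⟩ψ for ¬⟨D⟩ψ.
  InCore : SubCL φ → Fm → Set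
  InCore A (var p) = mem φ (var p) A
  InCore A (dia ψ) = mem φ (neg (dia ψ)) A
  InCore A (neg _) = ⊥
  InCore A (_ ∨ᶠ _) = ⊥

  InCore? : ∀ A → Decidable (InCore A)
  InCore? A (var p) = mem? (var p) A
  InCore? A (dia ψ) = mem? (neg (dia ψ)) A
  InCore? A (neg _) = no λ ()
  InCore? A (_ ∨ᶠ _) = no λ ()

  SameCore : SubCL φ → SubCL φ → Set
  SameCore A B = ∀ {ψ} → ψ ∈ subs φ → InCore A ψ ⇔ InCore B ψ

  module _ {A B : SubCL φ} (atomA : IsAtom φ A) (atomB : IsAtom φ B) where

    agree-neg : ∀ χ → χ ∈CL φ → mem φ χ A ⇔ mem φ χ B → mem φ (neg χ) A ⇔ mem φ (neg χ) B
    agree-neg χ χ∈ e = ⇔.trans (mem-neg χ atomA χ∈) (⇔.trans (¬-cong e) (⇔.sym (mem-neg χ atomB χ∈)))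

    agree-unneg : ∀ χ → χ ∈CL φ → mem φ (neg χ) A ⇔ mem φ (neg χ) B → mem φ χ A ⇔ mem φ χ B
    agree-unneg χ χ∈ e =
      ⇔.trans (IsAtom.negation atomA χ χ∈) (⇔.trans (¬-cong e) (⇔.sym (IsAtom.negation atomB χ χ∈)))

    sameCore⇒agree : SameCore A B →
      ∀ ψ → ψ ∈ subs φ → (mem φ ψ A ⇔ mem φ ψ B) × (mem φ (neg ψ) A ⇔ mem φ (neg ψ) B)
    sameCore⇒agree sameCore (var p) ψ∈ = sameCore ψ∈ , agree-neg (var p) (subs⇒∈CL ψ∈) (sameCore ψ∈)
    sameCore⇒agree sameCore (neg ψ) ψ∈ =
      agree¬ψ , ⇔.trans (⇔.sym (mem-¬¬ A)) (⇔.trans agreeψ (mem-¬¬ B))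
      where
      mem-¬¬ : ∀ C → mem φ ψ C ⇔ mem φ (neg (neg ψ)) C
      mem-¬¬ C = mem-nf C ψ (neg (neg ψ)) (sym (∼-involutive-nf ψ))
      IH = sameCore⇒agree sameCore ψ (subs-trans φ ψ∈ (there (subs-refl ψ)))
      agreeψ = proj₁ IH
      agree¬ψ = proj₂ IH
    sameCore⇒agree sameCore (ψ ∨ᶠ χ) ψ∨χ∈ = agree∨ , agree-neg (ψ ∨ᶠ χ) (subs⇒∈CL ψ∨χ∈) agree∨
      where
      agree : ∀ {θ} → θ ∈ subs (ψ ∨ᶠ χ) → mem φ θ A ⇔ mem φ θ B
      agree θ∈ = proj₁ (sameCore⇒agree sameCore _ (subs-trans φ ψ∨χ∈ θ∈))
      agreeψ = agree (there (∈-++⁺ˡ (subs-refl ψ)))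
      agreeχ = agree (there (∈-++⁺ʳ (subs ψ) (subs-refl χ)))
      agree∨ : mem φ (ψ ∨ᶠ χ) A ⇔ mem φ (ψ ∨ᶠ χ) B
      agree∨ = ⇔.trans (IsAtom.disjunction atomA ψ χ (subs⇒∈CL ψ∨χ∈))
              (⇔.trans (agreeψ ⊎-cong agreeχ) (⇔.sym (IsAtom.disjunction atomB ψ χ (subs⇒∈CL ψ∨χ∈))))
    sameCore⇒agree sameCore (dia ψ) ψ∈ = agree-unneg (dia ψ) (subs⇒∈CL ψ∈) (sameCore ψ∈) , sameCore ψ∈

  _⊑_ : SubCL φ → SubCL φ → Set
  A ⊑ B = ∀ {ψ} → InCore A ψ → InCore B ψ

  _⊒_ : SubCL φ → SubCL φ → Set
  A ⊒ B = B ⊑ A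

  ⊒-trans : ∀ {A B C} → A ⊒ B → B ⊒ C → A ⊒ C
  ⊒-trans A⊒B B⊒C = A⊒B ∘ B⊒C

  core-determines-atom : ∀ {A B} → IsAtom φ A → IsAtom φ B → SameCore A B → A ≡ B
  core-determines-atom atomA atomB sameCore =
    ⊆-antisym (sameCore⇒⊆ atomA atomB sameCore) (sameCore⇒⊆ atomB atomA (⇔.sym ∘ sameCore))
    where
    sameCore⇒⊆ : ∀ {A B} → IsAtom φ A → IsAtom φ B → SameCore A B → A ⊆ B
    sameCore⇒⊆ atomA atomB sameCore {i} i∈A =
      let ψ , ψ∈ , e = lookup-CL i
          agreeψ , agree¬ψ = sameCore⇒agree atomA atomB sameCore ψ ψ∈
      in [ (λ e → mem⇒∈ₛ ψ e (to agreeψ (i , e , i∈A)))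
         , (λ e → mem⇒∈ₛ (neg ψ) e (to agree¬ψ (i , e , i∈A))) ]′ e

  ⊑-antisym : ∀ {A B} → IsAtom φ A → IsAtom φ B → A ⊑ B → B ⊑ A → A ≡ B
  ⊑-antisym atomA atomB A⊑B B⊑A = core-determines-atom atomA atomB (λ _ → mk⇔ A⊑B B⊑A)

  step⇒⊒ : ∀ {A A'} → RowStep φ A A' → A ⊒ A'
  step⇒⊒ (_ , letters) {var p} = letters p
  step⇒⊒ {A} {A'} (boxes , _) {dia ψ} =
    to (mem-nf A (box (neg ψ)) (neg (dia ψ)) box¬ψ≡¬◇ψ) ∘ proj₂ ∘ boxes (neg ψ)
      ∘ from (mem-nf A' (box (neg ψ)) (neg (dia ψ)) box¬ψ≡¬◇ψ)
    where
    box¬ψ≡¬◇ψ : nf (box (neg ψ)) ≡ nf (neg (dia ψ))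
    box¬ψ≡¬◇ψ = cong (neg ∘ dia) (∼-involutive-nf ψ)

  row-cores-decreasing : ∀ {row} → IsRow φ row → AllPairs _⊒_ row
  row-cores-decreasing r =
    LinkedP.Linked⇒AllPairs ⊒-trans (Linked.map step⇒⊒ (IsRow.steps r))

  subformulas : List Fm
  subformulas = deduplicate _≟ᶠ_ (subs φ)

  coreSize : SubCL φ → ℕ
  coreSize A = length (filter (InCore? A) subformulas)

  coreSize≤size : ∀ A → coreSize A ≤ size φ
  coreSize≤size A = ListP.length-filter (InCore? A) subformulas

  ⊏⇒coreSize< : ∀ {A B} → IsAtom φ A → IsAtom φ B → A ⊑ B → A ≢ B → coreSize A < coreSize B
  ⊏⇒coreSize< {A} {B} atomA atomB A⊑B A≢B =
    ℕP.≤∧≢⇒< (length-filter-mono (InCore? A) (InCore? B) A⊑B subformulas) λ sizes≡ →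
      A≢B (core-determines-atom atomA atomB λ ψ∈ →
        mk⇔ A⊑B (length-filter-≡⇒⊇ (InCore? A) (InCore? B) A⊑B {subformulas} sizes≡
                   (∈-deduplicate⁺ _≟ᶠ_ ψ∈)))

  distinctCount≤suc-size : ∀ {row} → IsRow φ row → distinctCount row ≤ suc (size φ)
  distinctCount≤suc-size {row} r =
    subst (_≤ suc (size φ)) (ListP.length-map coreSize distinct)
      (length-strictly-decreasing (size φ) (AllP.map⁺ (All.tabulate λ {A} _ → coreSize≤size A)) decreasing)
    where
    distinct = deduplicate _≟ₛ_ row
    distinct⊆row = deduplicate-⊆ _≟ₛ_ row
    decreasing : AllPairs _>_ (map coreSize distinct)
    decreasing = AllPairsP.map⁺ (AllPairs-map-All
      (λ atomA atomB (A≢B , A⊒B) → ⊏⇒coreSize< atomB atomA A⊒B (A≢B ∘ sym))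
      (SublistP.All-resp-⊆ distinct⊆row (IsRow.atoms r))
      (AllPairs.zip (deduplicate-! _≟ₛ_ row , AllPairs-resp-⊆ distinct⊆row (row-cores-decreasing r))))

  maxFact-distinct : ∀ {row fac} → IsRow φ row → IsMaxFact row fac →
    AllPairs (λ p q → proj₁ p ≢ proj₁ q) fac
  maxFact-distinct {fac = fac} r mf = AllPairsP.map⁻ (sorted-adjacent-distinct⇒distinct {R = _⊒_}
      (λ atomA atomB A⊒B B⊒A → ⊑-antisym atomA atomB B⊒A A⊒B)
      (SublistP.All-resp-⊆ heads⊆row (IsRow.atoms r))
      (AllPairs-resp-⊆ heads⊆row (row-cores-decreasing r))
      (LinkedP.map⁺ (IsMaxFact.adjDistinct mf)))
    where
    heads⊆row = subst (map proj₁ fac ⊑ˡ_) (IsMaxFact.covers mf) (heads⊆expand (IsMaxFact.positive mf))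

lemma3p5 : (φ : Fm) (row : List (SubCL φ)) → IsRow φ row →
    (distinctCount row ≤ 2 * size φ) ×
    (∀ (fac : List (SubCL φ × ℕ)) → IsMaxFact row fac →
      AllPairs (λ p q → proj₁ p ≢ proj₁ q) fac)
lemma3p5 φ row r =
  ℕP.≤-trans (distinctCount≤suc-size r) (suc≤2* (size-positive φ)) , λ _ → maxFact-distinct r
  where open Atoms φ
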